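{- Let $\Sigma=(X,X_0,S,U,\to,Y,h)$ be an NTS and let $\sim\subseteq X\times X$ be an equivalence relation on $X$ such that $h(x)=h(x')$ for all $(x,x')\in\sim$. Assume that for all $x\in S$ and $x'\in X$, if $(x,x')\in\sim$ then $x'\in S$. Then the quotient relation $\sim_{\mathsf{Q}}=\{(x,[x])\mid x\in X\}\subseteq X\times X_\sim$ is an InfSOP bisimulation relation between $\Sigma$ and its quotient system $\Sigma_\sim$ if and only if $\sim$ is an InfSOP bisimulation relation between $\Sigma$ and itself.
   Context: A nondeterministic transition system (NTS) is a tuple $\Sigma=(X,X_0,S,U,\to,Y,h)$, where $X$ is a (possibly infinite) set of states, $X_0\subseteq X$ the initial states, $S\subseteq X$ the secret states, $U$ a (possibly infinite) set of inputs, $\to\subseteq X\times U\times X$ the transition relation (write $x\xrightarrow{u}x'$ for $(x,u,x')\in\to$), $Y$ a set of outputs and $h:X\to Y$ the output map. For an equivalence relation $\sim$ on $X$ with $h(x)=h(x')$ whenever $(x,x')\in\sim$, let $[x]=\{x'\in X\mid (x',x)\in\sim\}$. The quotient system is $\Sigma_\sim=(X_\sim,X_{\sim,0},S_\sim,U,\to_\sim,Y,h_\sim)$ with $X_\sim=\{[x]\mid x\in X\}$, $X_{\sim,0}=\{[x]\mid [x]\cap X_0\neq\emptyset\}$, $S_\sim=\{[x]\mid [x]\cap S\neq\emptyset\}$, $[x]\xrightarrow{u}_\sim[x']$ iff there exist $\bar x\in[x]$, $\bar x'\in[x']$ with $\bar x\xrightarrow{u}\bar x'$, and $h_\sim([x])=h(\bar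 x)$ for any $\bar x\in[x]$. For NTSs $\Sigma_1=(X_1,X_{1,0},S_1,U,\to_1,Y,h_1)$, $\Sigma_2=(X_2,X_{2,0},S_2,U,\to_2,Y,h_2)$, a relation $R\subseteq X_1\times X_2$ is an InfSOP bisimulation relation between $\Sigma_1$ and $\Sigma_2$ if: (1a) for every $x_{1,0}\in X_{1,0}\cap S_1$ there is $x_{2,0}\in X_{2,0}\cap S_2$ with $(x_{1,0},x_{2,0})\in R$; (1b) for every $x_{1,0}\in X_{1,0}\setminus S_1$ there is $x_{2,0}\in X_{2,0}\setminus S_2$ with $(x_{1,0},x_{2,0})\in R$; (1c) for every $x_{2,0}\in X_{2,0}\cap S_2$ there is $x_{1,0}\in X_{1,0}\cap S_1$ with $(x_{1,0},x_{2,0})\in R$; (1d) for every $x_{2,0}\in X_{2,0}\setminus S_2$ there is $x_{1,0}\in X_{1,0}\setminus S_1$ with $(x_{1,0},x_{2,0})\in R$; (2) $h_1(x_1)=h_2(x_2)$ for all $(x_1,x_2)\in R$; (3) for every $(x_1,x_2)\in R$ and every $u\in U$: (a) for every $x_1\xrightarrow{u}_1x_1'$ with $x_1'\in S_1$ there is $x_2\xrightarrow{u}_2x_2'$ with $x_2'\in S_2$ and $(x_1',x_2')\in R$; (b) for every $x_1\xrightarrow{u}_1x_1'$ with $x_1'\in X_1\setminus S_1$ there is $x_2\xrightarrow{u}_2x_2'$ with $x_2'\in X_2\setminus S_2$ and $(x_1',x_2')\in R$; (c) for every $x_2\xrightarrow{u}_2x_2'$ with $x_2'\in S_2$ there is $x_1\xrightarrow{u}_1x_1'$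 with $x_1'\in S_1$ and $(x_1',x_2')\in R$; (d) for every $x_2\xrightarrow{u}_2x_2'$ with $x_2'\in X_2\setminus S_2$ there is $x_1\xrightarrow{u}_1x_1'$ with $x_1'\in X_1\setminus S_1$ and $(x_1',x_2')\in R$. -}

module Defs where

open import Level using (Level; suc; _⊔_)
open import Data.Product using (Σ; ∃; _×_; _,_)
open import Relation.Nullary using (¬_)
open import Relation.Binary.PropositionalEquality using (_≡_)
open import Relation.Binary using (Rel; IsEquivalence)

-- A nondeterministic transition system Σ = (X, X₀, S, U, →, Y, h)
-- with input set U and output set Y as parameters (so that two systems
-- share U and Y, as required for InfSOP bisimulation).
record NTS {ℓ : Level} (U Y : Set ℓ) : Set (suc ℓ) where
  field
    X    : Set ℓ
    X₀   : X → Set ℓ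
    S    : X → Set ℓ
    Step : X → U → X → Set ℓ
    h    : X → Y
open NTS public

record IsInfSOPBisim {ℓ : Level} {U Y : Set ℓ} (Σ₁ Σ₂ : NTS U Y)
         (R : X Σ₁ → X Σ₂ → Set ℓ) : Set ℓ where
  field
    init-a : ∀ x₁ → X₀ Σ₁ x₁ → S Σ₁ x₁ →
               Σ (X Σ₂) λ x₂ → X₀ Σ₂ x₂ × S Σ₂ x₂ × R x₁ x₂
    init-b : ∀ x₁ → X₀ Σ₁ x₁ → ¬ S Σ₁ x₁ →
               Σ (X Σ₂) λ x₂ → X₀ Σ₂ x₂ × ¬ S Σ₂ x₂ × R x₁ x₂
    init-c : ∀ x₂ → X₀ Σ₂ x₂ → S Σ₂ x₂ →
               Σ (X Σ₁) λ x₁ → X₀ Σ₁ x₁ × S Σ₁ x₁ × R x₁ x₂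
    init-d : ∀ x₂ → X₀ Σ₂ x₂ → ¬ S Σ₂ x₂ →
               Σ (X Σ₁) λ x₁ → X₀ Σ₁ x₁ × ¬ S Σ₁ x₁ × R x₁ x₂
    out    : ∀ x₁ x₂ → R x₁ x₂ → h Σ₁ x₁ ≡ h Σ₂ x₂
    step-a : ∀ x₁ x₂ → R x₁ x₂ → ∀ u x₁' → Step Σ₁ x₁ u x₁' → S Σ₁ x₁' →
               Σ (X Σ₂) λ x₂' → Step Σ₂ x₂ u x₂' × S Σ₂ x₂' × R x₁' x₂'
    step-b : ∀ x₁ x₂ → R x₁ x₂ → ∀ u x₁' → Step Σ₁ x₁ u x₁' → ¬ S Σ₁ x₁' →
               Σ (X Σ₂) λ x₂' → Step Σ₂ x₂ u x₂' × ¬ S Σ₂ x₂' × R x₁' x₂'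
    step-c : ∀ x₁ x₂ → R x₁ x₂ → ∀ u x₂' → Step Σ₂ x₂ u x₂' → S Σ₂ x₂' →
               Σ (X Σ₁) λ x₁' → Step Σ₁ x₁ u x₁' × S Σ₁ x₁' × R x₁' x₂'
    step-d : ∀ x₁ x₂ → R x₁ x₂ → ∀ u x₂' → Step Σ₂ x₂ u x₂' → ¬ S Σ₂ x₂' →
               Σ (X Σ₁) λ x₁' → Step Σ₁ x₁ u x₁' × ¬ S Σ₁ x₁' × R x₁' x₂'

-- Agda (without cubical) has no quotient types, so the
-- equivalence class [x] is represented by any representative x; two
-- representatives denote the same class iff they are ∼-related.  All
-- components below are ∼-invariant, and read "[x] ∩ X₀ ≠ ∅" etc.
Quotient : {ℓ : Level} {U Y : Set ℓ} (Sys : NTS U Y) → Rel (X Sys) ℓ → NTS U Y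
Quotient Sys _∼_ = record
  { X    = X Sys
  ; X₀   = λ c → Σ (X Sys) λ x̄ → (x̄ ∼ c) × X₀ Sys x̄
  ; S    = λ c → Σ (X Sys) λ x̄ → (x̄ ∼ c) × S Sys x̄
  ; Step = λ c u c' → Σ (X Sys) λ x̄ → Σ (X Sys) λ x̄' →
             (x̄ ∼ c) × (x̄' ∼ c') × Step Sys x̄ u x̄'
  ; h    = h Sys
  }

-- The quotient relation ∼_Q = {(x,[x]) | x ∈ X}: x is related to the class
-- represented by c iff [x] = [c], i.e. iff x ∼ c.
QuotRel : {ℓ : Level} {U Y : Set ℓ} (Sys : NTS U Y) (_∼_ : Rel (X Sys) ℓ) →
          X Sys → X (Quotient Sys _∼_) → Set ℓ
QuotRel Sys _∼_ x c = x ∼ c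

module Submission where

open import Defs
open import Level using (Level)
open import Relation.Binary using (Rel; REL; IsEquivalence)
open import Relation.Binary.PropositionalEquality as ≡ using (_≡_)
open import Function.Base using (flip)
open import Function.Bundles using (_⇔_; mk⇔)
open import Data.Product using (Σ; _×_; _,_; map₂)
open import Relation.Nullary using (¬_)

_⨾_ : {ℓ : Level} {A B C : Set ℓ} → REL A B ℓ → REL B C ℓ → REL A C ℓ
(R ⨾ T) x z = Σ _ λ y → R x y × T y z

module _ {ℓ : Level} {U Y : Set ℓ} where

  bisim-converse : {Σ₁ Σ₂ : NTS U Y} {R : REL (X Σ₁) (X Σ₂) ℓ} →
    IsInfSOPBisim Σ₁ Σ₂ R → IsInfSOPBisim Σ₂ Σ₁ (flip R)
  bisim-converse B = record
    { init-a = init-c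
    ; init-b = init-d
    ; init-c = init-a
    ; init-d = init-b
    ; out    = λ x₂ x₁ r → ≡.sym (out x₁ x₂ r)
    ; step-a = λ x₂ x₁ → step-c x₁ x₂
    ; step-b = λ x₂ x₁ → step-d x₁ x₂
    ; step-c = λ x₂ x₁ → step-a x₁ x₂
    ; step-d = λ x₂ x₁ → step-b x₁ x₂
    }
    where open IsInfSOPBisim B

  bisim-compose : {Σ₁ Σ₂ Σ₃ : NTS U Y}
    {R : REL (X Σ₁) (X Σ₂) ℓ} {T : REL (X Σ₂) (X Σ₃) ℓ} →
    IsInfSOPBisim Σ₁ Σ₂ R → IsInfSOPBisim Σ₂ Σ₃ T → IsInfSOPBisim Σ₁ Σ₃ (R ⨾ T)
  bisim-compose BR BT = record
    { init-a = λ x₁ x₁₀ s₁ → let (x₂ , x₂₀ , s₂ , r) = R.init-a x₁ x₁₀ s₁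
                                 (x₃ , x₃₀ , s₃ , t) = T.init-a x₂ x₂₀ s₂
                             in x₃ , x₃₀ , s₃ , (x₂ , r , t)
    ; init-b = λ x₁ x₁₀ s₁ → let (x₂ , x₂₀ , s₂ , r) = R.init-b x₁ x₁₀ s₁
                                 (x₃ , x₃₀ , s₃ , t) = T.init-b x₂ x₂₀ s₂
                             in x₃ , x₃₀ , s₃ , (x₂ , r , t)
    ; init-c = λ x₃ x₃₀ s₃ → let (x₂ , x₂₀ , s₂ , t) = T.init-c x₃ x₃₀ s₃
                                 (x₁ , x₁₀ , s₁ , r) = R.init-c x₂ x₂₀ s₂
                             in x₁ , x₁₀ , s₁ , (x₂ , r , t)
    ; init-d = λ x₃ x₃₀ s₃ → let (x₂ , x₂₀ , s₂ , t) = T.init-d x₃ x₃₀ s₃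
                                 (x₁ , x₁₀ , s₁ , r) = R.init-d x₂ x₂₀ s₂
                             in x₁ , x₁₀ , s₁ , (x₂ , r , t)
    ; out    = λ { x₁ x₃ (x₂ , r , t) → ≡.trans (R.out x₁ x₂ r) (T.out x₂ x₃ t) }
    ; step-a = λ { x₁ x₃ (x₂ , r , t) u x₁' st₁ s₁ →
        let (x₂' , st₂ , s₂ , r') = R.step-a x₁ x₂ r u x₁' st₁ s₁
            (x₃' , st₃ , s₃ , t') = T.step-a x₂ x₃ t u x₂' st₂ s₂
        in x₃' , st₃ , s₃ , (x₂' , r' , t') }
    ; step-b = λ { x₁ x₃ (x₂ , r , t) u x₁' st₁ s₁ →
        let (x₂' , st₂ , s₂ , r') = R.step-b x₁ x₂ r u x₁' st₁ s₁
            (x₃' , st₃ , s₃ , t') = T.step-b x₂ x₃ t u x₂' st₂ s₂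
        in x₃' , st₃ , s₃ , (x₂' , r' , t') }
    ; step-c = λ { x₁ x₃ (x₂ , r , t) u x₃' st₃ s₃ →
        let (x₂' , st₂ , s₂ , t') = T.step-c x₂ x₃ t u x₃' st₃ s₃
            (x₁' , st₁ , s₁ , r') = R.step-c x₁ x₂ r u x₂' st₂ s₂
        in x₁' , st₁ , s₁ , (x₂' , r' , t') }
    ; step-d = λ { x₁ x₃ (x₂ , r , t) u x₃' st₃ s₃ →
        let (x₂' , st₂ , s₂ , t') = T.step-d x₂ x₃ t u x₃' st₃ s₃
            (x₁' , st₁ , s₁ , r') = R.step-d x₁ x₂ r u x₂' st₂ s₂
        in x₁' , st₁ , s₁ , (x₂' , r' , t') }
    }
    where
    module R = IsInfSOPBisim BR
    module T = IsInfSOPBisim BT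

  bisim-resp : {Σ₁ Σ₂ : NTS U Y} {R R' : REL (X Σ₁) (X Σ₂) ℓ} →
    (∀ {x₁ x₂} → R x₁ x₂ → R' x₁ x₂) → (∀ {x₁ x₂} → R' x₁ x₂ → R x₁ x₂) →
    IsInfSOPBisim Σ₁ Σ₂ R → IsInfSOPBisim Σ₁ Σ₂ R'
  bisim-resp R⇒R' R'⇒R B = record
    { init-a = λ x₁ x₁₀ s₁ → relabel R⇒R' (init-a x₁ x₁₀ s₁)
    ; init-b = λ x₁ x₁₀ s₁ → relabel R⇒R' (init-b x₁ x₁₀ s₁)
    ; init-c = λ x₂ x₂₀ s₂ → relabel R⇒R' (init-c x₂ x₂₀ s₂)
    ; init-d = λ x₂ x₂₀ s₂ → relabel R⇒R' (init-d x₂ x₂₀ s₂)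
    ; out    = λ x₁ x₂ r → out x₁ x₂ (R'⇒R r)
    ; step-a = λ x₁ x₂ r u x' st s → relabel R⇒R' (step-a x₁ x₂ (R'⇒R r) u x' st s)
    ; step-b = λ x₁ x₂ r u x' st s → relabel R⇒R' (step-b x₁ x₂ (R'⇒R r) u x' st s)
    ; step-c = λ x₁ x₂ r u x' st s → relabel R⇒R' (step-c x₁ x₂ (R'⇒R r) u x' st s)
    ; step-d = λ x₁ x₂ r u x' st s → relabel R⇒R' (step-d x₁ x₂ (R'⇒R r) u x' st s)
    }
    where
    open IsInfSOPBisim B
    relabel : {A : Set ℓ} {P Q rel rel' : A → Set ℓ} → (∀ {y} → rel y → rel' y) →
      Σ A (λ y → P y × Q y × rel y) → Σ A (λ y → P y × Q y × rel' y)
    relabel f = map₂ (map₂ (map₂ f))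

module QuotientFacts {ℓ : Level} {U Y : Set ℓ} (Sys : NTS U Y)
  {_∼_ : Rel (X Sys) ℓ} (isEquivalence : IsEquivalence _∼_) where

  open IsEquivalence isEquivalence

  Σ∼ : NTS U Y
  Σ∼ = Quotient Sys _∼_

  OutputRespecting : Set ℓ
  OutputRespecting = ∀ x x' → x ∼ x' → h Sys x ≡ h Sys x'

  SecretClosed : Set ℓ
  SecretClosed = ∀ x x' → S Sys x → x ∼ x' → S Sys x'

  class-initial : ∀ {x} → X₀ Sys x → X₀ Σ∼ x
  class-initial x₀ = _ , refl , x₀

  class-secret : ∀ {x} → S Sys x → S Σ∼ x
  class-secret s = _ , refl , s

  class-step : ∀ {x c u x'} → x ∼ c → Step Sys x u x' → Step Σ∼ c u x'
  class-step x∼c st = _ , _ , x∼c , refl , st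

  representative-public : ∀ {x c} → x ∼ c → ¬ S Σ∼ c → ¬ S Sys x
  representative-public x∼c ¬sc s = ¬sc (_ , x∼c , s)

  secret-representative : SecretClosed → ∀ {x c} → x ∼ c → S Σ∼ c → S Sys x
  secret-representative closed x∼c (y , y∼c , sy) = closed _ _ sy (trans y∼c (sym x∼c))

  public-class : SecretClosed → ∀ {x} → ¬ S Sys x → ¬ S Σ∼ x
  public-class closed ¬s sc = ¬s (secret-representative closed refl sc)

  ∼⇒common-class : ∀ {x y} → x ∼ y → (QuotRel Sys _∼_ ⨾ flip (QuotRel Sys _∼_)) x y
  ∼⇒common-class x∼y = _ , x∼y , refl

  common-class⇒∼ : ∀ {x y} → (QuotRel Sys _∼_ ⨾ flip (QuotRel Sys _∼_)) x y → x ∼ y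
  common-class⇒∼ (c , x∼c , y∼c) = trans x∼c (sym y∼c)

  -- (⇒) of Theorem 3.22: ∼ = ∼_Q ⨾ ∼_Q⁻¹ is a composite of bisimulations.
  quotient-bisim⇒self-bisim :
    IsInfSOPBisim Sys Σ∼ (QuotRel Sys _∼_) → IsInfSOPBisim Sys Sys _∼_
  quotient-bisim⇒self-bisim B =
    bisim-resp common-class⇒∼ ∼⇒common-class (bisim-compose B (bisim-converse B))

  -- (⇐) of Theorem 3.22.  Moves of Σ are matched by the same moves seen in
  -- Σ_∼ (this needs no bisimulation hypothesis); moves of Σ_∼ are moves of
  -- representatives, which ∼ transfers back to the given state.
  self-bisim⇒quotient-bisim : OutputRespecting → SecretClosed →
    IsInfSOPBisim Sys Sys _∼_ → IsInfSOPBisim Sys Σ∼ (QuotRel Sys _∼_)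
  self-bisim⇒quotient-bisim output closed B = record
    { init-a = λ x x₀ s → x , class-initial x₀ , class-secret s , refl
    ; init-b = λ x x₀ ¬s → x , class-initial x₀ , public-class closed ¬s , refl
    ; init-c = λ { c (x̄ , x̄∼c , x̄₀) sc →
        x̄ , x̄₀ , secret-representative closed x̄∼c sc , x̄∼c }
    ; init-d = λ { c (x̄ , x̄∼c , x̄₀) ¬sc →
        x̄ , x̄₀ , representative-public x̄∼c ¬sc , x̄∼c }
    ; out    = output
    ; step-a = λ x c x∼c u x' st s →
        x' , class-step x∼c st , class-secret s , refl
    ; step-b = λ x c x∼c u x' st ¬s →
        x' , class-step x∼c st , public-class closed ¬s , refl
    ; step-c = λ { x c x∼c u c' (x̄ , x̄' , x̄∼c , x̄'∼c' , st) sc' →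
        let (x' , st' , s' , x'∼x̄') = step-c x x̄ (trans x∼c (sym x̄∼c)) u x̄' st
                                         (secret-representative closed x̄'∼c' sc')
        in x' , st' , s' , trans x'∼x̄' x̄'∼c' }
    ; step-d = λ { x c x∼c u c' (x̄ , x̄' , x̄∼c , x̄'∼c' , st) ¬sc' →
        let (x' , st' , ¬s' , x'∼x̄') = step-d x x̄ (trans x∼c (sym x̄∼c)) u x̄' st
                                          (representative-public x̄'∼c' ¬sc')
        in x' , st' , ¬s' , trans x'∼x̄' x̄'∼c' }
    }
    where open IsInfSOPBisim B using (step-c; step-d)

theorem3p22 : {ℓ : Level} {U Y : Set ℓ} (Sys : NTS U Y) (_∼_ : Rel (X Sys) ℓ) →
    IsEquivalence _∼_ →
    (∀ x x' → x ∼ x' → h Sys x ≡ h Sys x') →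
    (∀ x x' → S Sys x → x ∼ x' → S Sys x') →
    IsInfSOPBisim Sys (Quotient Sys _∼_) (QuotRel Sys _∼_) ⇔ IsInfSOPBisim Sys Sys _∼_
theorem3p22 Sys _∼_ isEquivalence output closed =
  mk⇔ quotient-bisim⇒self-bisim (self-bisim⇒quotient-bisim output closed)
  where open QuotientFacts Sys isEquivalence
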